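{- Let $q\ge 2$ and let $f$ be a $(q^2-1,1)$-coloring of $H(q+1,q)$ whose first color class is a $1$-perfect code and such that the vertex set of the second color can be partitioned into lines. Then for every positive integer $p$ and every $t$ with $0\le t\le p-1$ there exists a $((q^2-1)(p-t),\ (q^2-1)t+p)$-coloring of $H(q+1,pq)$; its main eigenvalue is $q(p-1)-1$.
   Context: $H(n,q)$: vertex set $\mathbb{Z}_q^n$, two vertices adjacent iff they differ in exactly one coordinate. A line is a set of $q$ vertices obtained by fixing all coordinates but one and letting that one range over $\mathbb{Z}_q$. A $(b,c)$-coloring of $H(N,Q)$ is a surjective map from the vertices onto $\{1,2\}$ such that every vertex of color $1$ has exactly $b$ neighbors of color $2$ and every vertex of color $2$ has exactly $c$ neighbors of color $1$; its main eigenvalue is $N(Q-1)-(b+c)$. A $1$-perfect code is a vertex set $C$ such that every Hamming ball of radius $1$ contains exactly one element of $C$. -}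

module Defs where

open import Data.Nat using (ℕ; zero; suc; _+_; _*_; _∸_; _≤_; _≤?_)
open import Data.Nat.Properties using () renaming (_≟_ to _≟ℕ_)
open import Data.Integer using (ℤ; +_; _-_)
open import Data.Fin using (Fin; zero; suc)
open import Data.Fin.Properties using () renaming (_≟_ to _≟F_)
open import Data.Vec using (Vec; []; _∷_; lookup; _[_]≔_)
open import Data.Vec.Properties using (≡-dec)
open import Data.List using (List; [_]; map; concatMap; allFin; filter; length)
open import Data.List.Membership.Propositional using (_∈_)
open import Data.Product using (Σ; ∃; _×_; _,_)
open import Relation.Nullary using (yes; no)
open import Relation.Nullary.Decidable using (_×-dec_)
open import Relation.Binary.PropositionalEquality using (_≡_; _≢_)

Vertex : ℕ → ℕ → Set
Vertex N Q = Vec (Fin Q) N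

allVertices : (N Q : ℕ) → List (Vertex N Q)
allVertices zero    Q = [ [] ]
allVertices (suc N) Q = concatMap (λ a → map (a ∷_) (allVertices N Q)) (allFin Q)

dist : ∀ {N Q} → Vertex N Q → Vertex N Q → ℕ
dist []       []       = 0
dist (x ∷ xs) (y ∷ ys) with x ≟F y
... | yes _ = dist xs ys
... | no  _ = suc (dist xs ys)

Adjacent : ∀ {N Q} → Vertex N Q → Vertex N Q → Set
Adjacent v w = dist v w ≡ 1

Color : Set
Color = Fin 2

color1 color2 : Color
color1 = zero
color2 = suc zero

Coloring : ℕ → ℕ → Set
Coloring N Q = Vertex N Q → Color

nbrsOfColor : ∀ {N Q} → Coloring N Q → Vertex N Q → Color → ℕ
nbrsOfColor {N} {Q} f v k =
  length (filter (λ w → (dist v w ≟ℕ 1) ×-dec (f w ≟F k)) (allVertices N Q))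

IsColoring : (N Q b c : ℕ) → Coloring N Q → Set
IsColoring N Q b c f =
  (∀ (k : Color) → ∃ λ (v : Vertex N Q) → f v ≡ k)
  × (∀ v → f v ≡ color1 → nbrsOfColor f v color2 ≡ b)
  × (∀ v → f v ≡ color2 → nbrsOfColor f v color1 ≡ c)

mainEigenvalue : (N Q b c : ℕ) → ℤ
mainEigenvalue N Q b c = + (N * (Q ∸ 1)) - + (b + c)

IsPerfectCodeClass : ∀ {N Q} → Coloring N Q → Color → Set
IsPerfectCodeClass {N} {Q} f k =
  ∀ (v : Vertex N Q) →
    length (filter (λ w → (dist v w ≤? 1) ×-dec (f w ≟F k)) (allVertices N Q)) ≡ 1

-- A line is given by a direction i and a base vertex x; it is the set
-- { x [ i ]≔ a | a ∈ ℤ_Q }.  w lies on it iff w ≡ x [ i ]≔ (w_i).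
Line : ℕ → ℕ → Set
Line N Q = Fin N × Vertex N Q

OnLine : ∀ {N Q} → Line N Q → Vertex N Q → Set
OnLine (i , x) w = w ≡ x [ i ]≔ lookup w i

LinePartitionable : ∀ {N Q} → Coloring N Q → Color → Set
LinePartitionable {N} {Q} f k =
  Σ (List (Line N Q)) λ ls →
    (∀ ℓ → ℓ ∈ ls → ∀ w → OnLine ℓ w → f w ≡ k)
    × (∀ w → f w ≡ k →
        length (filter (λ { (i , x) → ≡-dec _≟F_ w (x [ i ]≔ lookup w i) }) ls) ≡ 1)

-- Write a symbol of ℤ_{pq} as level · q + base, with level ∈ ℤ_p and base ∈ ℤ_q, and let π send a
-- vertex of H(q+1, pq) to its vertex of bases in H(q+1, q). Above a vertex of colour 1 of f, colour
-- everything 1. Above a vertex y of colour 2, let d be the direction of the partition line through y,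
-- and colour x by the sum of the levels of x outside coordinate d, taken modulo p: colour 1 for the
-- t smallest residues and colour 2 otherwise. Moving along direction d never changes the colour,
-- since the whole partition line lies above colour-2 vertices with the same d; along any other
-- direction the p lifts of a base symbol run through all residues, so t of them get colour 1 and
-- p − t colour 2. Off its partition line a colour-2 vertex of f has one colour-1 and q² − 1 colour-2
-- neighbours, so counting fibre by fibre gives p + (q² − 1)t colour-1 and (q² − 1)(p − t) colour-2
-- neighbours above it; above a colour-1 vertex only its q² − 1 colour-2 neighbours contribute.

module Submission where

open import Algebra.Properties.CommutativeSemigroup using (x∙yz≈y∙xz)
open import Data.Bool using (Bool; true; false; if_then_else_; _∧_)
open import Data.Empty using (⊥-elim)
open import Data.Fin using (Fin; zero; suc; toℕ; _↑ˡ_; _↑ʳ_; combine; remQuot; punchIn; fromℕ<)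
open import Data.Fin.Properties
  using (toℕ<n; toℕ-inject₁; toℕ-fromℕ; toℕ-fromℕ<; remQuot-combine; punchInᵢ≢i)
  renaming (_≟_ to _≟F_)
open import Data.Integer using (+_; _-_; _⊖_)
open import Data.Integer.Properties using ([+m]-[+n]≡m⊖n; +-cancelˡ-⊖)
open import Data.List using (List; []; _∷_; _++_; filter; length; concatMap; tabulate)
import Data.List as List
open import Data.List.Membership.Propositional using (_∈_)
open import Data.List.Membership.Propositional.Properties using (∈-filter⁺; ∈-filter⁻)
open import Data.List.Properties using (length-++; filter-++)
open import Data.List.Relation.Unary.Any using (here; there)
open import Data.Nat using (ℕ; zero; suc; _+_; _*_; _∸_; _≤_; _<_; s≤s; _⊓_; _<ᵇ_; _%_)
open import Data.Nat.DivMod using ([m+n]%n≡m%n; m<n⇒m%n≡m)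
open import Data.Nat.Properties
  using (+-*-semiring; +-commutativeSemigroup; +-identityʳ; +-comm; +-assoc; +-suc; +-cancelˡ-≡;
         *-identityʳ; *-identityˡ; *-zeroʳ; <⇒≤; m≤n⇒∃[o]m+o≡n; m≥n⇒m⊓n≡n; m+n∸m≡n)
  renaming (_≟_ to _≟ℕ_)
open import Data.Nat.Tactic.RingSolver using (solve-∀)
open import Data.Product using (Σ; ∃; _×_; _,_; proj₁; proj₂; uncurry)
open import Data.Vec using (Vec; lookup; _[_]≔_; _∷_; [])
import Data.Vec as Vec
open import Data.Vec.Properties
  using ([]≔-lookup; []≔-idempotent; lookup∘update; lookup∘update′; lookup-map; map-[]≔; ≡-dec)
open import Function using (_∘_)
open import Relation.Binary.PropositionalEquality
  using (_≡_; refl; sym; trans; cong; cong₂; subst; _≗_; _≢_; module ≡-Reasoning)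
open import Relation.Nullary using (yes; no; does; ¬_)
open import Relation.Nullary.Decidable using (_×-dec_)
open import Relation.Unary using (Decidable)

open import Defs
open import Algebra.Properties.Semiring.Sum +-*-semiring
  using (sum; sum-syntax; sum-cong-≗; sum-replicate-zero; sum-init-last; ∑-distrib-+; ∑-comm; *-distribʳ-sum)

𝟙 : Bool → ℕ
𝟙 true  = 1
𝟙 false = 0

𝟙-∧ : ∀ a b → 𝟙 (a ∧ b) ≡ 𝟙 a * 𝟙 b
𝟙-∧ true  b = sym (+-identityʳ (𝟙 b))
𝟙-∧ false b = refl

δ : ∀ {n} → Fin n → Fin n → ℕ
δ a b = 𝟙 (does (a ≟F b))

δ-color1+δ-color2 : ∀ c → δ c color1 + δ c color2 ≡ 1
δ-color1+δ-color2 zero       = refl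
δ-color1+δ-color2 (suc zero) = refl

color1≢color2 : color1 ≢ color2
color1≢color2 ()

sum-const : ∀ n c → ∑[ i < n ] c ≡ n * c
sum-const zero    c = refl
sum-const (suc n) c = cong (_+_ c) (sum-const n c)

without : ∀ {n} → Fin n → (Fin n → ℕ) → Fin n → ℕ
without j F i = if does (j ≟F i) then 0 else F i

without-cong : ∀ {n} (j : Fin n) {F G : Fin n → ℕ} →
  (∀ i → j ≢ i → F i ≡ G i) → without j F ≗ without j G
without-cong j F≡G i with j ≟F i
... | yes _   = refl
... | no  j≢i = F≡G i j≢i

without-+* : ∀ {n} (j : Fin n) (F G : Fin n → ℕ) c e →
  without j (λ i → F i * c + G i * e) ≗ λ i → without j F i * c + without j G i * e
without-+* j F G c e i with does (j ≟F i)
... | true  = refl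
... | false = refl

without-zero : ∀ {n} (j : Fin n) {F : Fin n → ℕ} {i} → F i ≡ 0 → without j F i ≡ 0
without-zero j {i = i} Fi≡0 with does (j ≟F i)
... | true  = refl
... | false = Fi≡0

sum-select : ∀ {n} (j : Fin n) (A B : Fin n → ℕ) →
  ∑[ i < n ] (if does (j ≟F i) then A i else B i) ≡ A j + sum (without j B)
sum-select zero    A B = refl
sum-select (suc j) A B =
  trans (cong (_+_ (B zero)) (sum-select j (A ∘ suc) (B ∘ suc)))
        (x∙yz≈y∙xz +-commutativeSemigroup (B zero) (A (suc j)) _)

sum-without : ∀ {n} (j : Fin n) (F : Fin n → ℕ) → sum F ≡ F j + sum (without j F)
sum-without j F = trans (sum-cong-≗ unselect) (sum-select j F F)
  where
  unselect : ∀ i → F i ≡ (if does (j ≟F i) then F i else F i)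
  unselect i with does (j ≟F i)
  ... | true  = refl
  ... | false = refl

sum-pick : ∀ {n} (j : Fin n) (A : Fin n → ℕ) →
  ∑[ i < n ] (if does (j ≟F i) then A i else 0) ≡ A j
sum-pick {n} j A = begin
  ∑[ i < n ] (if does (j ≟F i) then A i else 0)
    ≡⟨ sum-select j A (λ _ → 0) ⟩
  A j + sum {n} (without j (λ _ → 0))
    ≡⟨ cong (_+_ (A j)) (sum-cong-≗ {n} λ i → without-zero j {λ _ → 0} refl) ⟩
  A j + sum {n} (λ _ → 0)
    ≡⟨ cong (_+_ (A j)) (sum-replicate-zero n) ⟩
  A j + 0
    ≡⟨ +-identityʳ (A j) ⟩
  A j
    ∎
  where open ≡-Reasoning

sum-*+* : ∀ {n} (F G : Fin n → ℕ) c e → ∑[ i < n ] (F i * c + G i * e) ≡ sum F * c + sum G * e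
sum-*+* F G c e =
  trans (∑-distrib-+ (λ i → F i * c) (λ i → G i * e))
        (sym (cong₂ _+_ (*-distribʳ-sum c F) (*-distribʳ-sum e G)))

sum-↑ : ∀ m n (h : Fin (m + n) → ℕ) → sum h ≡ ∑[ i < m ] h (i ↑ˡ n) + ∑[ i < n ] h (m ↑ʳ i)
sum-↑ zero    n h = refl
sum-↑ (suc m) n h = trans (cong (_+_ (h zero)) (sum-↑ m n (h ∘ suc))) (sym (+-assoc (h zero) _ _))

sum-combine : ∀ m n (h : Fin (m * n) → ℕ) → sum h ≡ ∑[ i < m ] ∑[ j < n ] h (combine i j)
sum-combine zero    n h = refl
sum-combine (suc m) n h =
  trans (sum-↑ n (m * n) h) (cong (_+_ (∑[ j < n ] h (j ↑ˡ (m * n)))) (sum-combine m n (h ∘ (n ↑ʳ_))))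

module _ (h : ℕ → ℕ) where

  window-cons : ∀ K n → ∑[ i < suc n ] h (K + toℕ i) ≡ h K + ∑[ i < n ] h (suc K + toℕ i)
  window-cons K n = cong₂ _+_ (cong h (+-identityʳ K)) (sum-cong-≗ {n} λ i → cong h (+-suc K (toℕ i)))

  window-snoc : ∀ K n → ∑[ i < suc n ] h (K + toℕ i) ≡ ∑[ i < n ] h (K + toℕ i) + h (K + n)
  window-snoc K n =
    trans (sum-init-last {n} (λ i → h (K + toℕ i)))
          (cong₂ _+_ (sum-cong-≗ {n} λ i → cong (λ m → h (K + m)) (toℕ-inject₁ i))
                     (cong (λ m → h (K + m)) (toℕ-fromℕ n)))

  window-periodic : ∀ p → (∀ s → h (s + p) ≡ h s) →
    ∀ K → ∑[ i < p ] h (K + toℕ i) ≡ ∑[ i < p ] h (toℕ i)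
  window-periodic p periodic zero    = refl
  window-periodic p periodic (suc K) = trans shift (window-periodic p periodic K)
    where
    shift : ∑[ i < p ] h (suc K + toℕ i) ≡ ∑[ i < p ] h (K + toℕ i)
    shift = +-cancelˡ-≡ (h K) _ _ (begin
      h K + ∑[ i < p ] h (suc K + toℕ i)   ≡⟨ window-cons K p ⟨
      ∑[ i < suc p ] h (K + toℕ i)         ≡⟨ window-snoc K p ⟩
      ∑[ i < p ] h (K + toℕ i) + h (K + p) ≡⟨ cong (_+_ (∑[ i < p ] h (K + toℕ i))) (periodic K) ⟩
      ∑[ i < p ] h (K + toℕ i) + h K       ≡⟨ +-comm _ (h K) ⟩
      h K + ∑[ i < p ] h (K + toℕ i)       ∎)
      where open ≡-Reasoning

sum-<ᵇ : ∀ n t → ∑[ i < n ] 𝟙 (toℕ i <ᵇ t) ≡ n ⊓ t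
sum-<ᵇ zero    t       = refl
sum-<ᵇ (suc n) zero    = sum-replicate-zero n
sum-<ᵇ (suc n) (suc t) = cong suc (sum-<ᵇ n t)

<ᵇ-irrefl : ∀ n → (n <ᵇ n) ≡ false
<ᵇ-irrefl zero    = refl
<ᵇ-irrefl (suc n) = <ᵇ-irrefl n

module Stripes (p′ t : ℕ) where

  p : ℕ
  p = suc p′

  stripe : ℕ → Color
  stripe s = if s % p <ᵇ t then color1 else color2

  windowCount : Color → ℕ
  windowCount zero       = t
  windowCount (suc zero) = p ∸ t

  window-color1 : t ≤ p → ∀ K → ∑[ ζ < p ] δ (stripe (K + toℕ ζ)) color1 ≡ t
  window-color1 t≤p K = begin
    ∑[ ζ < p ] δ (stripe (K + toℕ ζ)) color1
      ≡⟨ sum-cong-≗ {p} (λ ζ → δ-stripe (K + toℕ ζ)) ⟩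
    ∑[ ζ < p ] h (K + toℕ ζ)
      ≡⟨ window-periodic h p (λ s → cong (λ m → 𝟙 (m <ᵇ t)) ([m+n]%n≡m%n s p)) K ⟩
    ∑[ ζ < p ] h (toℕ ζ)
      ≡⟨ sum-cong-≗ {p} (λ ζ → cong (λ m → 𝟙 (m <ᵇ t)) (m<n⇒m%n≡m (toℕ<n ζ))) ⟩
    ∑[ ζ < p ] 𝟙 (toℕ ζ <ᵇ t)
      ≡⟨ sum-<ᵇ p t ⟩
    p ⊓ t
      ≡⟨ m≥n⇒m⊓n≡n t≤p ⟩
    t
      ∎
    where
    open ≡-Reasoning
    h : ℕ → ℕ
    h s = 𝟙 (s % p <ᵇ t)
    δ-stripe : ∀ s → δ (stripe s) color1 ≡ h s
    δ-stripe s with s % p <ᵇ t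
    ... | true  = refl
    ... | false = refl

  stripe-threshold : t < p → stripe t ≡ color2
  stripe-threshold t<p =
    trans (cong (λ m → if m <ᵇ t then color1 else color2) (m<n⇒m%n≡m t<p))
          (cong (λ b → if b then color1 else color2) (<ᵇ-irrefl t))

  window : t ≤ p → ∀ K k → ∑[ ζ < p ] δ (stripe (K + toℕ ζ)) k ≡ windowCount k
  window t≤p K zero       = window-color1 t≤p K
  window t≤p K (suc zero) = begin
    n₂                 ≡⟨ m+n∸m≡n t n₂ ⟨
    t + n₂ ∸ t         ≡⟨ cong (λ m → m + n₂ ∸ t) (window-color1 t≤p K) ⟨
    n₁ + n₂ ∸ t        ≡⟨ cong (_∸ t) (∑-distrib-+ {p} (χ color1) (χ color2)) ⟨
    ∑[ ζ < p ] (χ color1 ζ + χ color2 ζ) ∸ t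
                       ≡⟨ cong (_∸ t) (sum-cong-≗ {p} λ ζ → δ-color1+δ-color2 (stripe (K + toℕ ζ))) ⟩
    ∑[ ζ < p ] 1 ∸ t   ≡⟨ cong (_∸ t) (trans (sum-const p 1) (*-identityʳ p)) ⟩
    p ∸ t              ∎
    where
    open ≡-Reasoning
    χ : Color → Fin p → ℕ
    χ k ζ = δ (stripe (K + toℕ ζ)) k
    n₁ n₂ : ℕ
    n₁ = sum (χ color1)
    n₂ = sum (χ color2)

sumVertices : ∀ {N Q} → (Vertex N Q → ℕ) → ℕ
sumVertices {zero}      h = h []
sumVertices {suc N} {Q} h = ∑[ a < Q ] sumVertices (λ ws → h (a ∷ ws))

lineSum : ∀ {N Q} → Vertex N Q → Fin N → (Vertex N Q → ℕ) → ℕ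
lineSum {Q = Q} v j R = ∑[ a < Q ] R (v [ j ]≔ a)

lineNbrSum : ∀ {N Q} → Vertex N Q → Fin N → (Vertex N Q → ℕ) → ℕ
lineNbrSum v j R = sum (without (lookup v j) (λ a → R (v [ j ]≔ a)))

nbrSum : ∀ {N Q} → Vertex N Q → (Vertex N Q → ℕ) → ℕ
nbrSum {N} v R = ∑[ j < N ] lineNbrSum v j R

lineSum≡self+lineNbrSum : ∀ {N Q} (v : Vertex N Q) j R → lineSum v j R ≡ R v + lineNbrSum v j R
lineSum≡self+lineNbrSum v j R =
  trans (sum-without (lookup v j) _) (cong (λ w → R w + lineNbrSum v j R) ([]≔-lookup v j))

lineNbrSum≡lineSum : ∀ {N Q} (v : Vertex N Q) j R → R v ≡ 0 → lineNbrSum v j R ≡ lineSum v j R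
lineNbrSum≡lineSum v j R Rv≡0 =
  sym (trans (lineSum≡self+lineNbrSum v j R) (cong (_+ lineNbrSum v j R) Rv≡0))

module _ {A : Set} {P : A → Set} (P? : Decidable P) where

  length-filter-map : ∀ {B : Set} (f : B → A) xs →
    length (filter P? (List.map f xs)) ≡ length (filter (P? ∘ f) xs)
  length-filter-map f []       = refl
  length-filter-map f (x ∷ xs) with does (P? (f x))
  ... | true  = cong suc (length-filter-map f xs)
  ... | false = length-filter-map f xs

  length-filter-concatMap : ∀ {B : Set} {n} (g : B → List A) (f : Fin n → B) →
    length (filter P? (concatMap g (tabulate f))) ≡ ∑[ i < n ] length (filter P? (g (f i)))
  length-filter-concatMap {n = zero}  g f = refl
  length-filter-concatMap {n = suc n} g f = begin
    length (filter P? (g (f zero) ++ concatMap g (tabulate (f ∘ suc))))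
      ≡⟨ cong length (filter-++ P? (g (f zero)) _) ⟩
    length (filter P? (g (f zero)) ++ filter P? (concatMap g (tabulate (f ∘ suc))))
      ≡⟨ length-++ (filter P? (g (f zero))) ⟩
    length (filter P? (g (f zero))) + length (filter P? (concatMap g (tabulate (f ∘ suc))))
      ≡⟨ cong (_+_ (length (filter P? (g (f zero))))) (length-filter-concatMap g (f ∘ suc)) ⟩
    ∑[ i < suc n ] length (filter P? (g (f i)))
      ∎
    where open ≡-Reasoning

length-filter-allVertices : ∀ N Q {P : Vertex N Q → Set} (P? : Decidable P) →
  length (filter P? (allVertices N Q)) ≡ sumVertices (λ w → 𝟙 (does (P? w)))
length-filter-allVertices zero Q P? with does (P? [])
... | true  = refl
... | false = refl
length-filter-allVertices (suc N) Q P? =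
  trans (length-filter-concatMap P? (λ a → List.map (a ∷_) (allVertices N Q)) (λ a → a))
        (sum-cong-≗ λ a → trans (length-filter-map P? (a ∷_) (allVertices N Q))
                                (length-filter-allVertices N Q (P? ∘ (a ∷_))))

sumVertices-cong : ∀ {N Q} {h h′ : Vertex N Q → ℕ} → h ≗ h′ → sumVertices h ≡ sumVertices h′
sumVertices-cong {zero}  h≗h′ = h≗h′ []
sumVertices-cong {suc N} h≗h′ = sum-cong-≗ λ a → sumVertices-cong (h≗h′ ∘ (a ∷_))

sumVertices-zero : ∀ N Q → sumVertices {N} {Q} (λ _ → 0) ≡ 0
sumVertices-zero zero    Q = refl
sumVertices-zero (suc N) Q = trans (sum-cong-≗ {Q} λ _ → sumVertices-zero N Q) (sum-replicate-zero Q)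

atDist : ∀ {N Q} → ℕ → Vertex N Q → Vertex N Q → ℕ
atDist r v w = 𝟙 (does (dist v w ≟ℕ r))

sumVertices-atDist0 : ∀ {N Q} (v : Vertex N Q) (R : Vertex N Q → ℕ) →
  sumVertices (λ w → atDist 0 v w * R w) ≡ R v
sumVertices-atDist0 []                 R = +-identityʳ (R [])
sumVertices-atDist0 {suc N} {Q} (x ∷ xs) R =
  trans (sum-cong-≗ fibre) (sum-pick x (λ a → R (a ∷ xs)))
  where
  fibre : ∀ a → sumVertices (λ ws → atDist 0 (x ∷ xs) (a ∷ ws) * R (a ∷ ws))
              ≡ (if does (x ≟F a) then R (a ∷ xs) else 0)
  fibre a with x ≟F a
  ... | yes refl = sumVertices-atDist0 xs (R ∘ (a ∷_))
  ... | no  _    = sumVertices-zero N Q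

sumVertices-atDist1 : ∀ {N Q} (v : Vertex N Q) (R : Vertex N Q → ℕ) →
  sumVertices (λ w → atDist 1 v w * R w) ≡ nbrSum v R
sumVertices-atDist1 []       R = refl
sumVertices-atDist1 (x ∷ xs) R =
  trans (sum-cong-≗ fibre)
        (trans (sum-select x _ (λ a → R (a ∷ xs))) (+-comm (nbrSum xs (R ∘ (x ∷_))) _))
  where
  fibre : ∀ a → sumVertices (λ ws → atDist 1 (x ∷ xs) (a ∷ ws) * R (a ∷ ws))
              ≡ (if does (x ≟F a) then nbrSum xs (R ∘ (a ∷_)) else R (a ∷ xs))
  fibre a with x ≟F a
  ... | yes refl = sumVertices-atDist1 xs (R ∘ (a ∷_))
  ... | no  _    = sumVertices-atDist0 xs (R ∘ (a ∷_))

nbrsOfColor≡nbrSum : ∀ {N Q} (f : Coloring N Q) v k → nbrsOfColor f v k ≡ nbrSum v (λ w → δ (f w) k)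
nbrsOfColor≡nbrSum {N} {Q} f v k =
  trans (length-filter-allVertices N Q (λ w → (dist v w ≟ℕ 1) ×-dec (f w ≟F k)))
        (trans (sumVertices-cong λ w → 𝟙-∧ (does (dist v w ≟ℕ 1)) (does (f w ≟F k)))
               (sumVertices-atDist1 v _))

module _ {A : Set} {P : A → Set} (P? : Decidable P) where

  unique-of-length-filter≡1 : ∀ xs → length (filter P? xs) ≡ 1 →
    Σ A λ a → (a ∈ xs × P a) × (∀ {b} → b ∈ xs → P b → b ≡ a)
  unique-of-length-filter≡1 xs eq with filter P? xs in e
  unique-of-length-filter≡1 xs refl | a ∷ [] =
    a , ∈-filter⁻ P? (subst (a ∈_) (sym e) (here refl)) , unique
    where
    unique : ∀ {b} → b ∈ xs → P b → b ≡ a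
    unique b∈xs pb with subst (_ ∈_) e (∈-filter⁺ P? b∈xs pb)
    ... | here b≡a = b≡a

OnLine-[]≔ : ∀ {N Q} (ℓ : Line N Q) {y} → OnLine ℓ y → ∀ β → OnLine ℓ (y [ proj₁ ℓ ]≔ β)
OnLine-[]≔ (i , x) {y} y∈ℓ β = begin
  y [ i ]≔ β                     ≡⟨ cong (_[ i ]≔ β) y∈ℓ ⟩
  (x [ i ]≔ lookup y i) [ i ]≔ β ≡⟨ []≔-idempotent x i ⟩
  x [ i ]≔ β                     ≡⟨ cong (x [ i ]≔_) (lookup∘update i y β) ⟨
  x [ i ]≔ lookup (y [ i ]≔ β) i ∎
  where open ≡-Reasoning

module LineDirection {n Q} (f : Coloring (suc n) Q) (lp : LinePartitionable f color2) where

  onLine? : (y : Vertex (suc n) Q) → Decidable (λ ℓ → OnLine ℓ y)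
  onLine? y (i , x) = ≡-dec _≟F_ y (x [ i ]≔ lookup y i)

  dirIn : List (Line (suc n) Q) → Vertex (suc n) Q → Fin (suc n)
  dirIn []       y = zero  -- junk value: y lies on no listed line
  dirIn (ℓ ∷ ls) y = if does (onLine? y ℓ) then proj₁ ℓ else dirIn ls y

  dirIn-unique : ∀ {ls y ℓ} → ℓ ∈ ls → OnLine ℓ y →
    (∀ {ℓ′} → ℓ′ ∈ ls → OnLine ℓ′ y → ℓ′ ≡ ℓ) → dirIn ls y ≡ proj₁ ℓ
  dirIn-unique {ℓ′ ∷ ls} {y} ℓ∈ y∈ℓ unique with onLine? y ℓ′ | ℓ∈
  ... | yes y∈ℓ′ | _          = cong proj₁ (unique (here refl) y∈ℓ′)
  ... | no  y∉ℓ′ | here refl  = ⊥-elim (y∉ℓ′ y∈ℓ)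
  ... | no  _    | there ℓ∈ls = dirIn-unique ℓ∈ls y∈ℓ (unique ∘ there)

  dir : Vertex (suc n) Q → Fin (suc n)
  dir = dirIn (proj₁ lp)

  private
    partition-line : ∀ {w} → f w ≡ color2 →
      Σ (Line (suc n) Q) λ ℓ →
        (ℓ ∈ proj₁ lp × OnLine ℓ w) × (∀ {ℓ′} → ℓ′ ∈ proj₁ lp → OnLine ℓ′ w → ℓ′ ≡ ℓ)
    partition-line {w} fw≡2 = unique-of-length-filter≡1 (onLine? w) (proj₁ lp) (proj₂ (proj₂ lp) w fw≡2)

  dir-on-line : ∀ {w ℓ} → f w ≡ color2 → ℓ ∈ proj₁ lp → OnLine ℓ w → dir w ≡ proj₁ ℓ
  dir-on-line fw≡2 ℓ∈ w∈ℓ with partition-line fw≡2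
  ... | _ , _ , unique =
    dirIn-unique ℓ∈ w∈ℓ λ ℓ′∈ w∈ℓ′ → trans (unique ℓ′∈ w∈ℓ′) (sym (unique ℓ∈ w∈ℓ))

  line-through : ∀ {y j} → f y ≡ color2 → dir y ≡ j →
    ∀ β → f (y [ j ]≔ β) ≡ color2 × dir (y [ j ]≔ β) ≡ j
  line-through {y} fy≡2 refl β with partition-line fy≡2
  ... | ℓ , (ℓ∈ , y∈ℓ) , _ = fy′≡2 , trans (dir-on-line fy′≡2 ℓ∈ y′∈ℓ) (sym dir-y)
    where
    dir-y : dir y ≡ proj₁ ℓ
    dir-y = dir-on-line fy≡2 ℓ∈ y∈ℓ
    y′∈ℓ : OnLine ℓ (y [ dir y ]≔ β)
    y′∈ℓ = subst (λ i → OnLine ℓ (y [ i ]≔ β)) (sym dir-y) (OnLine-[]≔ ℓ y∈ℓ β)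
    fy′≡2 : f (y [ dir y ]≔ β) ≡ color2
    fy′≡2 = proj₁ (proj₂ lp) ℓ ℓ∈ _ y′∈ℓ

  line-through⁻ : ∀ {y j β} → f (y [ j ]≔ β) ≡ color2 → dir (y [ j ]≔ β) ≡ j →
    f y ≡ color2 × dir y ≡ j
  line-through⁻ {y} {j} f≡2 dir≡j =
    subst (λ w → f w ≡ color2 × dir w ≡ j)
          (trans ([]≔-idempotent y j) ([]≔-lookup y j))
          (line-through f≡2 dir≡j (lookup y j))

module Construction (q p′ t : ℕ) (t<p : t < suc p′)
                    (f : Coloring (suc q) q) (lp : LinePartitionable f color2) where

  open Stripes p′ t
  open LineDirection f lp

  Vertex′ : Set
  Vertex′ = Vertex (suc q) (p * q)

  base : Fin (p * q) → Fin q
  base b = proj₂ (remQuot {p} q b)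

  level : Fin (p * q) → ℕ
  level b = toℕ (proj₁ (remQuot {p} q b))

  base-combine : ∀ ζ β → base (combine ζ β) ≡ β
  base-combine ζ β = cong proj₂ (remQuot-combine ζ β)

  level-combine : ∀ ζ β → level (combine ζ β) ≡ toℕ ζ
  level-combine ζ β = cong (toℕ ∘ proj₁) (remQuot-combine ζ β)

  π : Vertex′ → Vertex (suc q) q
  π = Vec.map base

  π-[]≔ : ∀ x j ζ β → π (x [ j ]≔ combine ζ β) ≡ π x [ j ]≔ β
  π-[]≔ x j ζ β = trans (map-[]≔ base x j) (cong (π x [ j ]≔_) (base-combine ζ β))

  height : Vertex′ → Fin (suc q) → ℕ
  height x d = sum (without d (level ∘ lookup x))

  heightAway : Vertex′ → Fin (suc q) → Fin (suc q) → ℕ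
  heightAway x j d = sum (without j (without d (level ∘ lookup x)))

  height-[]≔-same : ∀ x d b → height (x [ d ]≔ b) d ≡ height x d
  height-[]≔-same x d b =
    sum-cong-≗ (without-cong d λ i d≢i → cong level (lookup∘update′ (d≢i ∘ sym) x b))

  height-[]≔ : ∀ x {j d} b → j ≢ d → height (x [ j ]≔ b) d ≡ heightAway x j d + level b
  height-[]≔ x {j} {d} b j≢d = begin
    height (x [ j ]≔ b) d
      ≡⟨ sum-without j (without d (level ∘ lookup (x [ j ]≔ b))) ⟩
    without d (level ∘ lookup (x [ j ]≔ b)) j + heightAway (x [ j ]≔ b) j d
      ≡⟨ cong₂ _+_ at-j away-j ⟩
    level b + heightAway x j d
      ≡⟨ +-comm (level b) _ ⟩
    heightAway x j d + level b
      ∎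
    where
    open ≡-Reasoning
    at-j : without d (level ∘ lookup (x [ j ]≔ b)) j ≡ level b
    at-j with d ≟F j
    ... | yes d≡j = ⊥-elim (j≢d (sym d≡j))
    ... | no  _   = cong level (lookup∘update j x b)
    away-j : heightAway (x [ j ]≔ b) j d ≡ heightAway x j d
    away-j = sum-cong-≗ (without-cong j λ i j≢i →
               without-cong d (λ _ _ → cong level (lookup∘update′ (j≢i ∘ sym) x b)) i)

  colourAbove : Color → Vertex′ → Color
  colourAbove zero       x = color1
  colourAbove (suc zero) x = stripe (height x (dir (π x)))

  g : Coloring (suc q) (p * q)
  g x = colourAbove (f (π x)) x

  χf : Color → Vertex (suc q) q → ℕ
  χf k w = δ (f w) k

  χg : Color → Vertex′ → ℕ
  χg k w = δ (g w) k

  codeCount : Color → ℕ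
  codeCount zero       = p
  codeCount (suc zero) = 0

  fibreCount : Color → Color → ℕ
  fibreCount zero       = codeCount
  fibreCount (suc zero) = windowCount

  fibreCount-split : ∀ c k → fibreCount c k ≡ δ c color1 * codeCount k + δ c color2 * windowCount k
  fibreCount-split zero       k = sym (trans (+-identityʳ _) (+-identityʳ _))
  fibreCount-split (suc zero) k = sym (+-identityʳ _)

  g-code : ∀ x → f (π x) ≡ color1 → g x ≡ color1
  g-code x fπx≡1 = cong (λ c → colourAbove c x) fπx≡1

  g-stripe : ∀ x → f (π x) ≡ color2 → g x ≡ stripe (height x (dir (π x)))
  g-stripe x fπx≡2 = cong (λ c → colourAbove c x) fπx≡2

  g-along-dir : ∀ x b → f (π x) ≡ color2 → g (x [ dir (π x) ]≔ b) ≡ g x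
  g-along-dir x b fπx≡2 = begin
    g x′                                ≡⟨ g-stripe x′ (trans (cong f πx′) fy′≡2) ⟩
    stripe (height x′ (dir (π x′)))     ≡⟨ cong (λ y → stripe (height x′ (dir y))) πx′ ⟩
    stripe (height x′ (dir y′))         ≡⟨ cong (λ d → stripe (height x′ d)) dir-y′ ⟩
    stripe (height x′ (dir (π x)))      ≡⟨ cong stripe (height-[]≔-same x (dir (π x)) b) ⟩
    stripe (height x (dir (π x)))       ≡⟨ g-stripe x fπx≡2 ⟨
    g x                                 ∎
    where
    open ≡-Reasoning
    x′ = x [ dir (π x) ]≔ b
    y′ = π x [ dir (π x) ]≔ base b
    πx′ : π x′ ≡ y′
    πx′ = map-[]≔ base x (dir (π x))
    fy′≡2 = proj₁ (line-through fπx≡2 refl (base b))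
    dir-y′ = proj₂ (line-through fπx≡2 refl (base b))

  sum-codeCount : ∀ k → ∑[ ζ < p ] δ color1 k ≡ codeCount k
  sum-codeCount zero       = trans (sum-const p 1) (*-identityʳ p)
  sum-codeCount (suc zero) = sum-replicate-zero p

  fibre-count : ∀ x j β k → ¬ (f (π x [ j ]≔ β) ≡ color2 × dir (π x [ j ]≔ β) ≡ j) →
    ∑[ ζ < p ] χg k (x [ j ]≔ combine ζ β) ≡ fibreCount (f (π x [ j ]≔ β)) k
  fibre-count x j β k off-partition-line with f (π x [ j ]≔ β) in fy′≡c
  ... | zero     = trans (sum-cong-≗ λ ζ → cong (λ c → δ c k) (g-code _ (f-above ζ))) (sum-codeCount k)
    where
    f-above : ∀ ζ → f (π (x [ j ]≔ combine ζ β)) ≡ color1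
    f-above ζ = trans (cong f (π-[]≔ x j ζ β)) fy′≡c
  ... | suc zero =
    trans (sum-cong-≗ λ ζ → cong (λ c → δ c k) (stripe-at ζ)) (window (<⇒≤ t<p) (heightAway x j d) k)
    where
    open ≡-Reasoning
    d = dir (π x [ j ]≔ β)
    j≢d : j ≢ d
    j≢d j≡d = off-partition-line (refl , sym j≡d)
    stripe-at : ∀ ζ → g (x [ j ]≔ combine ζ β) ≡ stripe (heightAway x j d + toℕ ζ)
    stripe-at ζ = begin
      g x′
        ≡⟨ g-stripe x′ (trans (cong f (π-[]≔ x j ζ β)) fy′≡c) ⟩
      stripe (height x′ (dir (π x′)))
        ≡⟨ cong (λ y → stripe (height x′ (dir y))) (π-[]≔ x j ζ β) ⟩
      stripe (height x′ d)
        ≡⟨ cong stripe (height-[]≔ x (combine ζ β) j≢d) ⟩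
      stripe (heightAway x j d + level b)
        ≡⟨ cong (λ l → stripe (heightAway x j d + l)) (level-combine ζ β) ⟩
      stripe (heightAway x j d + toℕ ζ)
        ∎
      where
      b = combine ζ β
      x′ = x [ j ]≔ b

  lineSum-g : ∀ x j k → (f (π x) ≡ color2 → dir (π x) ≢ j) →
    lineSum x j (χg k)
      ≡ lineSum (π x) j (χf color1) * codeCount k + lineSum (π x) j (χf color2) * windowCount k
  lineSum-g x j k not-dir = begin
    ∑[ b < p * q ] χg k (x [ j ]≔ b)
      ≡⟨ sum-combine p q _ ⟩
    ∑[ ζ < p ] ∑[ β < q ] χg k (x [ j ]≔ combine ζ β)
      ≡⟨ ∑-comm {p} {q} (λ ζ β → χg k (x [ j ]≔ combine ζ β)) ⟩
    ∑[ β < q ] ∑[ ζ < p ] χg k (x [ j ]≔ combine ζ β)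
      ≡⟨ sum-cong-≗ (λ β → fibre-count x j β k (off-partition-line β)) ⟩
    ∑[ β < q ] fibreCount (F β) k
      ≡⟨ sum-cong-≗ (λ β → fibreCount-split (F β) k) ⟩
    ∑[ β < q ] (δ (F β) color1 * codeCount k + δ (F β) color2 * windowCount k)
      ≡⟨ sum-*+* (λ β → δ (F β) color1) (λ β → δ (F β) color2) (codeCount k) (windowCount k) ⟩
    ∑[ β < q ] δ (F β) color1 * codeCount k + ∑[ β < q ] δ (F β) color2 * windowCount k
      ∎
    where
    open ≡-Reasoning
    F : Fin q → Color
    F β = f (π x [ j ]≔ β)
    off-partition-line : ∀ β → ¬ (F β ≡ color2 × dir (π x [ j ]≔ β) ≡ j)
    off-partition-line β (Fβ≡2 , dir≡j) = uncurry not-dir (line-through⁻ Fβ≡2 dir≡j)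

  nbrsOfColor-g-over-code : ∀ x → f (π x) ≡ color1 →
    nbrsOfColor g x color2 ≡ nbrsOfColor f (π x) color2 * (p ∸ t)
  nbrsOfColor-g-over-code x fπx≡1 = begin
    nbrsOfColor g x color2
      ≡⟨ nbrsOfColor≡nbrSum g x color2 ⟩
    ∑[ j < suc q ] lineNbrSum x j (χg color2)
      ≡⟨ sum-cong-≗ along ⟩
    ∑[ j < suc q ] (lineNbrSum y j (χf color2) * (p ∸ t))
      ≡⟨ *-distribʳ-sum (p ∸ t) (λ j → lineNbrSum y j (χf color2)) ⟨
    nbrSum y (χf color2) * (p ∸ t)
      ≡⟨ cong (_* (p ∸ t)) (nbrsOfColor≡nbrSum f y color2) ⟨
    nbrsOfColor f y color2 * (p ∸ t)
      ∎
    where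
    open ≡-Reasoning
    y = π x
    along : ∀ j → lineNbrSum x j (χg color2) ≡ lineNbrSum y j (χf color2) * (p ∸ t)
    along j = begin
      lineNbrSum x j (χg color2)
        ≡⟨ lineNbrSum≡lineSum x j (χg color2) (cong (λ c → δ c color2) (g-code x fπx≡1)) ⟩
      lineSum x j (χg color2)
        ≡⟨ lineSum-g x j color2 (λ fy≡2 → ⊥-elim (color1≢color2 (trans (sym fπx≡1) fy≡2))) ⟩
      lineSum y j (χf color1) * 0 + lineSum y j (χf color2) * (p ∸ t)
        ≡⟨ cong (_+ lineSum y j (χf color2) * (p ∸ t)) (*-zeroʳ (lineSum y j (χf color1))) ⟩
      lineSum y j (χf color2) * (p ∸ t)
        ≡⟨ cong (_* (p ∸ t)) (lineNbrSum≡lineSum y j (χf color2) (cong (λ c → δ c color2) fπx≡1)) ⟨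
      lineNbrSum y j (χf color2) * (p ∸ t)
        ∎

  module _ (x : Vertex′) (fπx≡2 : f (π x) ≡ color2) where

    private
      y = π x
      d = dir y

      L : Color → Fin (suc q) → ℕ
      L c j = lineSum y j (χf c)

      S : Color → ℕ
      S c = sum (without d (L c))

      S-color1 : nbrsOfColor f y color1 ≡ 1 → S color1 ≡ 1
      S-color1 one-code-nbr = begin
        S color1                       ≡⟨ sum-cong-≗ (without-cong d λ j _ → lineNbrSum≡L j) ⟨
        sum (without d N)              ≡⟨ cong (_+ sum (without d N)) (trans (lineNbrSum≡L d) L-color1-dir) ⟨
        N d + sum (without d N)        ≡⟨ sum-without d N ⟨
        nbrSum y (χf color1)           ≡⟨ nbrsOfColor≡nbrSum f y color1 ⟨
        nbrsOfColor f y color1         ≡⟨ one-code-nbr ⟩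
        1                              ∎
        where
        open ≡-Reasoning
        N : Fin (suc q) → ℕ
        N j = lineNbrSum y j (χf color1)
        lineNbrSum≡L : ∀ j → N j ≡ L color1 j
        lineNbrSum≡L j = lineNbrSum≡lineSum y j (χf color1) (cong (λ c → δ c color1) fπx≡2)
        L-color1-dir : L color1 d ≡ 0
        L-color1-dir =
          trans (sum-cong-≗ λ β → cong (λ c → δ c color1) (proj₁ (line-through fπx≡2 refl β)))
                (sum-replicate-zero q)

      S-color1+S-color2 : S color1 + S color2 ≡ q * q
      S-color1+S-color2 = begin
        S color1 + S color2
          ≡⟨ ∑-distrib-+ (without d (L color1)) (without d (L color2)) ⟨
        ∑[ j < suc q ] (without d (L color1) j + without d (L color2) j)
          ≡⟨ sum-cong-≗ whole-line ⟩
        sum (without d (λ _ → q))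
          ≡⟨ +-cancelˡ-≡ q _ _ (trans (sym (sum-const (suc q) q)) (sum-without d (λ _ → q))) ⟨
        q * q
          ∎
        where
        open ≡-Reasoning
        L-color1+L-color2 : ∀ j → L color1 j + L color2 j ≡ q
        L-color1+L-color2 j = begin
          L color1 j + L color2 j
            ≡⟨ ∑-distrib-+ (λ β → χf color1 (y [ j ]≔ β)) (λ β → χf color2 (y [ j ]≔ β)) ⟨
          ∑[ β < q ] (χf color1 (y [ j ]≔ β) + χf color2 (y [ j ]≔ β))
            ≡⟨ sum-cong-≗ (λ β → δ-color1+δ-color2 (f (y [ j ]≔ β))) ⟩
          ∑[ β < q ] 1
            ≡⟨ trans (sum-const q 1) (*-identityʳ q) ⟩
          q ∎
        whole-line : ∀ j → without d (L color1) j + without d (L color2) j ≡ without d (λ _ → q) j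
        whole-line j with does (d ≟F j)
        ... | true  = refl
        ... | false = L-color1+L-color2 j

    nbrsOfColor-g-over-lines : nbrsOfColor f y color1 ≡ 1 → ∀ k → δ (g x) k ≡ 0 →
      nbrsOfColor g x k ≡ codeCount k + (q * q ∸ 1) * windowCount k
    nbrsOfColor-g-over-lines one-code-nbr k gx≢k = begin
      nbrsOfColor g x k
        ≡⟨ nbrsOfColor≡nbrSum g x k ⟩
      nbrSum x (χg k)
        ≡⟨ sum-without d (λ j → lineNbrSum x j (χg k)) ⟩
      lineNbrSum x d (χg k) + sum (without d (λ j → lineNbrSum x j (χg k)))
        ≡⟨ cong₂ _+_ along-dir (sum-cong-≗ (without-cong d across)) ⟩
      sum (without d (λ j → L color1 j * codeCount k + L color2 j * windowCount k))
        ≡⟨ sum-cong-≗ (without-+* d (L color1) (L color2) (codeCount k) (windowCount k)) ⟩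
      ∑[ j < suc q ] (without d (L color1) j * codeCount k + without d (L color2) j * windowCount k)
        ≡⟨ sum-*+* (without d (L color1)) (without d (L color2)) (codeCount k) (windowCount k) ⟩
      S color1 * codeCount k + S color2 * windowCount k
        ≡⟨ cong₂ (λ m n → m * codeCount k + n * windowCount k) S₁≡1 S₂≡q²-1 ⟩
      1 * codeCount k + (q * q ∸ 1) * windowCount k
        ≡⟨ cong (_+ (q * q ∸ 1) * windowCount k) (*-identityˡ (codeCount k)) ⟩
      codeCount k + (q * q ∸ 1) * windowCount k
        ∎
      where
      open ≡-Reasoning
      S₁≡1 : S color1 ≡ 1
      S₁≡1 = S-color1 one-code-nbr
      S₂≡q²-1 : S color2 ≡ q * q ∸ 1
      S₂≡q²-1 = trans (sym (m+n∸m≡n 1 (S color2)))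
                      (cong (_∸ 1) (trans (cong (_+ S color2) (sym S₁≡1)) S-color1+S-color2))
      along-dir : lineNbrSum x d (χg k) ≡ 0
      along-dir = begin
        lineNbrSum x d (χg k)
          ≡⟨ lineNbrSum≡lineSum x d (χg k) gx≢k ⟩
        ∑[ b < p * q ] χg k (x [ d ]≔ b)
          ≡⟨ sum-cong-≗ (λ b → trans (cong (λ c → δ c k) (g-along-dir x b fπx≡2)) gx≢k) ⟩
        ∑[ b < p * q ] 0
          ≡⟨ sum-replicate-zero (p * q) ⟩
        0
          ∎
      across : ∀ j → d ≢ j → lineNbrSum x j (χg k) ≡ L color1 j * codeCount k + L color2 j * windowCount k
      across j d≢j = trans (lineNbrSum≡lineSum x j (χg k) gx≢k) (lineSum-g x j k λ _ → d≢j)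

  flat : Vertex (suc q) q → Vertex′
  flat = Vec.map (combine {p} zero)

  π-flat : ∀ {n} (y : Vec (Fin q) n) → Vec.map base (Vec.map (combine {p} zero) y) ≡ y
  π-flat []      = refl
  π-flat (β ∷ y) = cong₂ _∷_ (base-combine zero β) (π-flat y)

  g-hits-color2 : ∀ y → f y ≡ color2 → ∃ λ x → g x ≡ color2
  g-hits-color2 y fy≡2 = x , (begin
    g x                                        ≡⟨ g-stripe x (trans (cong f πx≡y) fy≡2) ⟩
    stripe (height x (dir (π x)))              ≡⟨ cong (λ w → stripe (height x (dir w))) πx≡y ⟩
    stripe (height x d)                        ≡⟨ cong stripe (height-[]≔ (flat y) b j≢d) ⟩
    stripe (heightAway (flat y) j d + level b) ≡⟨ cong₂ (λ m n → stripe (m + n)) flat-heightAway level-b ⟩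
    stripe t                                   ≡⟨ stripe-threshold t<p ⟩
    color2                                     ∎)
    where
    open ≡-Reasoning
    d = dir y
    -- Any coordinate other than d will do; punchIn d just needs some element of Fin q.
    j = punchIn d (lookup y d)
    j≢d = punchInᵢ≢i d (lookup y d)
    ζ = fromℕ< t<p
    b = combine ζ (lookup y j)
    x = flat y [ j ]≔ b
    πx≡y : π x ≡ y
    πx≡y = trans (π-[]≔ (flat y) j ζ (lookup y j))
                 (trans (cong (_[ j ]≔ lookup y j) (π-flat y)) ([]≔-lookup y j))
    level-b : level b ≡ t
    level-b = trans (level-combine ζ (lookup y j)) (toℕ-fromℕ< t<p)
    flat-level : ∀ i → level (lookup (flat y) i) ≡ 0
    flat-level i = trans (cong level (lookup-map i (combine {p} zero) y)) (level-combine zero (lookup y i))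
    flat-heightAway : heightAway (flat y) j d ≡ 0
    flat-heightAway =
      trans (sum-cong-≗ λ i → without-zero j {without d (level ∘ lookup (flat y))}
                                (without-zero d {level ∘ lookup (flat y)} (flat-level i)))
            (sum-replicate-zero (suc q))

  g-isColoring : IsColoring (suc q) q (q * q ∸ 1) 1 f →
    IsColoring (suc q) (p * q) ((q * q ∸ 1) * (p ∸ t)) ((q * q ∸ 1) * t + p) g
  g-isColoring (f-onto , f-code , f-line) = g-onto , g-code-count , g-line-count
    where
    g-onto : ∀ k → ∃ λ x → g x ≡ k
    g-onto zero with f-onto color1
    ... | y , fy≡1 = flat y , g-code (flat y) (trans (cong f (π-flat y)) fy≡1)
    g-onto (suc zero) with f-onto color2
    ... | y , fy≡2 = g-hits-color2 y fy≡2
    g-code-count : ∀ x → g x ≡ color1 → nbrsOfColor g x color2 ≡ (q * q ∸ 1) * (p ∸ t)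
    g-code-count x gx≡1 = over (f (π x)) refl
      where
      over : ∀ c → f (π x) ≡ c → nbrsOfColor g x color2 ≡ (q * q ∸ 1) * (p ∸ t)
      over zero       fπx = trans (nbrsOfColor-g-over-code x fπx) (cong (_* (p ∸ t)) (f-code (π x) fπx))
      over (suc zero) fπx =
        nbrsOfColor-g-over-lines x fπx (f-line (π x) fπx) color2 (cong (λ c → δ c color2) gx≡1)
    g-line-count : ∀ x → g x ≡ color2 → nbrsOfColor g x color1 ≡ (q * q ∸ 1) * t + p
    g-line-count x gx≡2 = over (f (π x)) refl
      where
      over : ∀ c → f (π x) ≡ c → nbrsOfColor g x color1 ≡ (q * q ∸ 1) * t + p
      over zero       fπx = ⊥-elim (color1≢color2 (trans (sym (g-code x fπx)) gx≡2))
      over (suc zero) fπx =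
        trans (nbrsOfColor-g-over-lines x fπx (f-line (π x) fπx) color1 (cong (λ c → δ c color1) gx≡2))
              (+-comm p _)

[+a]-[+b]≡[+c]-[+d] : ∀ a b c d → a + d ≡ c + b → + a - + b ≡ + c - + d
[+a]-[+b]≡[+c]-[+d] a b c d a+d≡c+b = begin
  + a - + b         ≡⟨ [+m]-[+n]≡m⊖n a b ⟩
  a ⊖ b             ≡⟨ +-cancelˡ-⊖ d a b ⟨
  (d + a) ⊖ (d + b) ≡⟨ cong₂ _⊖_ (trans (+-comm d a) (trans a+d≡c+b (+-comm c b))) (+-comm d b) ⟩
  (b + c) ⊖ (b + d) ≡⟨ +-cancelˡ-⊖ b c d ⟩
  c ⊖ d             ≡⟨ [+m]-[+n]≡m⊖n c d ⟨
  + c - + d         ∎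
  where open ≡-Reasoning

[1+m+n]∸m≡1+n : ∀ m n → suc (m + n) ∸ m ≡ suc n
[1+m+n]∸m≡1+n zero    n = refl
[1+m+n]∸m≡1+n (suc m) n = [1+m+n]∸m≡1+n m n

mainEigenvalue≡ : ∀ N Q b c e → N * (Q ∸ 1) + 1 ≡ e + (b + c) → mainEigenvalue N Q b c ≡ + e - + 1
mainEigenvalue≡ N Q b c e = [+a]-[+b]≡[+c]-[+d] (N * (Q ∸ 1)) (b + c) e 1

-- The eigenvalue equation for q = q₁ + 1 and p = t + s + 1, with the subtractions moved across.
eigenvalue-identity : ∀ q₁ t s →
  suc (suc q₁) * (q₁ + (t + s) * suc q₁) + 1
    ≡ suc q₁ * (t + s) + ((q₁ + q₁ * suc q₁) * suc s + ((q₁ + q₁ * suc q₁) * t + suc (t + s)))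
eigenvalue-identity = solve-∀

mainEigenvalue-construction : ∀ q₁ p′ t → t ≤ p′ →
  mainEigenvalue (suc (suc q₁)) (suc p′ * suc q₁)
    ((suc q₁ * suc q₁ ∸ 1) * (suc p′ ∸ t)) ((suc q₁ * suc q₁ ∸ 1) * t + suc p′)
    ≡ + (suc q₁ * (suc p′ ∸ 1)) - + 1
mainEigenvalue-construction q₁ p′ t t≤p′ with m≤n⇒∃[o]m+o≡n t≤p′
... | s , refl rewrite [1+m+n]∸m≡1+n t s =
  mainEigenvalue≡ (suc (suc q₁)) (suc (t + s) * suc q₁) (q²-1 * suc s) (q²-1 * t + suc (t + s))
                  (suc q₁ * (t + s)) (eigenvalue-identity q₁ t s)
  where
  q²-1 = suc q₁ * suc q₁ ∸ 1

theorem8 : (q : ℕ) → 2 ≤ q →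
    (f : Coloring (suc q) q) →
    IsColoring (suc q) q (q * q ∸ 1) 1 f →
    IsPerfectCodeClass f color1 →
    LinePartitionable f color2 →
    (p : ℕ) → 1 ≤ p → (t : ℕ) → t ≤ p ∸ 1 →
    Σ (Coloring (suc q) (p * q))
      (λ g → IsColoring (suc q) (p * q) ((q * q ∸ 1) * (p ∸ t)) ((q * q ∸ 1) * t + p) g)
    × (mainEigenvalue (suc q) (p * q) ((q * q ∸ 1) * (p ∸ t)) ((q * q ∸ 1) * t + p)
        ≡ + (q * (p ∸ 1)) - + 1)
theorem8 (suc q₁) _ f f-coloring _ lines (suc p′) _ t t≤p′ =
  (g , g-isColoring f-coloring) , mainEigenvalue-construction q₁ p′ t t≤p′
  where open Construction (suc q₁) p′ t (s≤s t≤p′) f lines
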